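{- Let $\mathbb{F}$ be a finite field and let $\mathcal{C}_1\subset\mathcal{C}\subseteq\mathbb{F}^n$ be linear codes with $\dim\mathcal{C}/\mathcal{C}_1=1$, and let $\mathcal{D}=\mathcal{C}^\perp\subset\mathcal{D}_1=\mathcal{C}_1^\perp$ (so $\dim\mathcal{D}_1/\mathcal{D}=1$). Suppose there exist vectors $a_1,\ldots,a_w$ and $b_1,\ldots,b_w$ in $\mathbb{F}^n$ such that $a_i\ast b_j\in\mathcal{D}$ whenever $i+j\leq w$, and $a_i\ast b_j\in\mathcal{D}_1\setminus\mathcal{D}$ whenever $i+j=w+1$. Then $d(\mathcal{C}/\mathcal{C}_1)\geq w$.
   Context: $\perp$ is with respect to the standard inner product on $\mathbb{F}^n$; $x\ast y$ is the coordinatewise (Hadamard) product. For codes $\mathcal{C}'\subsetneq\mathcal{C}$, $d(\mathcal{C}/\mathcal{C}')=\min\{d(x,0): x\in\mathcal{C},\ x\notin\mathcal{C}'\}$, where $d$ is the Hamming distance. -}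

module Defs where

open import Level using (Level; _⊔_) renaming (suc to lsuc)
open import Algebra.Bundles using (CommutativeRing)
open import Data.Nat using (ℕ; zero; suc; _≤_)
open import Data.Fin using (Fin; zero; suc)
open import Data.Product using (Σ; ∃; _×_; _,_)
open import Relation.Nullary using (¬_; Dec; yes; no)
open import Relation.Unary using (Pred; _⊆_)
open import Relation.Binary using (Decidable)
open import Function using (Surjective)
open import Relation.Binary.PropositionalEquality using (_≡_)

record FiniteField (c ℓ : Level) : Set (lsuc (c ⊔ ℓ)) where
  field
    commRing : CommutativeRing c ℓ
  open CommutativeRing commRing public
  field
    _≟_      : Decidable _≈_
    0≉1      : ¬ (0# ≈ 1#)
    inverse  : ∀ x → ¬ (x ≈ 0#) → ∃ λ y → x * y ≈ 1#
    size     : ℕ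
    enum     : Fin size → Carrier
    enum-surj : ∀ x → ∃ λ k → enum k ≈ x

module Code {c ℓ : Level} (F : FiniteField c ℓ) where
  open FiniteField F hiding (zero)

  Vec : ℕ → Set c
  Vec n = Fin n → Carrier

  _≋_ : ∀ {n} → Vec n → Vec n → Set ℓ
  u ≋ v = ∀ i → u i ≈ v i

  0v : ∀ {n} → Vec n
  0v _ = 0#

  _+v_ : ∀ {n} → Vec n → Vec n → Vec n
  (u +v v) i = u i + v i

  _·v_ : ∀ {n} → Carrier → Vec n → Vec n
  (λ' ·v v) i = λ' * v i

  _∗_ : ∀ {n} → Vec n → Vec n → Vec n
  (u ∗ v) i = u i * v i

  Σᶠ : ∀ n → (Fin n → Carrier) → Carrier
  Σᶠ zero    f = 0#
  Σᶠ (suc n) f = f zero + Σᶠ n (λ i → f (suc i))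

  ⟨_,_⟩ : ∀ {n} → Vec n → Vec n → Carrier
  ⟨_,_⟩ {n} u v = Σᶠ n (λ i → u i * v i)

  record IsLinearCode {p} {n : ℕ} (C : Pred (Vec n) p) : Set (c ⊔ ℓ ⊔ p) where
    field
      respects : ∀ {u v} → u ≋ v → C u → C v
      has-0    : C 0v
      closed-+ : ∀ {u v} → C u → C v → C (u +v v)
      closed-· : ∀ λ' {u} → C u → C (λ' ·v u)

  _⊥ : ∀ {p n} → Pred (Vec n) p → Pred (Vec n) (c ⊔ ℓ ⊔ p)
  (C ⊥) x = ∀ y → C y → ⟨ x , y ⟩ ≈ 0#

  -- C₁ ⊆ C and dim (C / C₁) = 1: there is c₀ ∈ C \ C₁ whose class spans C/C₁
  QuotDimOne : ∀ {p n} → Pred (Vec n) p → Pred (Vec n) p → Set (c ⊔ ℓ ⊔ p)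
  QuotDimOne {n = n} C C₁ =
    (C₁ ⊆ C) ×
    (Σ (Vec n) λ c₀ → C c₀ × ¬ C₁ c₀ ×
      (∀ x → C x → Σ Carrier λ λ' → Σ (Vec n) λ y → C₁ y × (x ≋ ((λ' ·v c₀) +v y))))

  hamming : ∀ {n} → Vec n → Vec n → ℕ
  hamming {zero}  u v = 0
  hamming {suc n} u v with u zero ≟ v zero
  ... | yes _ = hamming {n} (λ i → u (suc i)) (λ i → v (suc i))
  ... | no  _ = suc (hamming {n} (λ i → u (suc i)) (λ i → v (suc i)))

  -- d(C/C₁) ≥ w, where d(C/C₁) = min { d(x,0) : x ∈ C, x ∉ C₁ }
  QuotDist≥ : ∀ {p n} → Pred (Vec n) p → Pred (Vec n) p → ℕ → Set (c ⊔ p)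
  QuotDist≥ C C₁ w = ∀ x → C x → ¬ C₁ x → w ≤ hamming x 0v

{-# OPTIONS --safe #-}
-- For x ∈ C \ C₁, every v ∈ D₁ = C₁⊥ with ⟨v, x⟩ = 0 lies in D = C⊥, since
-- C = C₁ + F x.  So the w × w matrix M i j = ⟨a i ∗ b j , x⟩ vanishes above
-- the anti-diagonal and is nonzero on it.  Choose a coordinate k where the
-- anti-diagonal entry ⟨a₁ ∗ b_w , x⟩ has a nonzero term, clear a₂ … a_w at k
-- using a₁, set x k to 0 and drop a₁ and b_w: this leaves a staircase of size
-- w - 1 and one fewer nonzero coordinate of x, so induction gives wt x ≥ w.
module Submission where

open import Defs
open import Level using (Level)
open import Function using (_∘_)
open import Data.Nat using (ℕ; zero; suc; _≤_; z≤n; s≤s)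
import Data.Nat as Nat
open import Data.Nat.Properties using (m≤n+m; ≤-trans; ≤-reflexive; m≤n⇒m≤1+n)
open import Data.Fin using (Fin; toℕ; fromℕ; inject₁)
open import Data.Fin.Properties using (toℕ-fromℕ; toℕ-inject₁) renaming (_≟_ to _≟ᶠ_)
open import Data.Vec.Functional using (updateAt)
open import Data.Vec.Functional.Properties using (updateAt-minimal)
open import Data.Product using (∃; _×_; _,_; proj₁; proj₂)
open import Data.Empty using (⊥-elim)
open import Relation.Nullary using (¬_; yes; no)
open import Relation.Unary using (Pred)
open import Relation.Binary.PropositionalEquality
  using (_≡_; cong; subst) renaming (refl to ≡-refl; sym to ≡-sym; trans to ≡-trans)
import Algebra.Properties.Ring as RingProperties
import Algebra.Properties.CommutativeSemigroup as CommutativeSemigroupProperties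

-- The paper's 1-based index sum i + j.
_⊞_ : ∀ {m n} → Fin m → Fin n → ℕ
i ⊞ j = suc (toℕ i) Nat.+ suc (toℕ j)

⊞-suc-inject₁ : ∀ {m n} (i : Fin m) (j : Fin n) → Fin.suc i ⊞ inject₁ j ≡ suc (i ⊞ j)
⊞-suc-inject₁ i j = cong (λ t → suc (suc (toℕ i) Nat.+ suc t)) (toℕ-inject₁ j)

zero⊞inject₁≤⊞ : ∀ {m n} (i : Fin m) (j : Fin n) → Fin.zero {m} ⊞ inject₁ j ≤ i ⊞ j
zero⊞inject₁≤⊞ i j rewrite toℕ-inject₁ j = s≤s (m≤n+m (suc (toℕ j)) (toℕ i))

module _ {c ℓ : Level} (F : FiniteField c ℓ) where
  open FiniteField F hiding (zero)
  open Code F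
  open RingProperties ring using (-‿distribˡ-*)
  open CommutativeSemigroupProperties +-commutativeSemigroup using () renaming (interchange to +-interchange)
  open import Relation.Binary.Reasoning.Setoid setoid

  *≉0⇒≉0ˡ : ∀ {x y} → ¬ x * y ≈ 0# → ¬ x ≈ 0#
  *≉0⇒≉0ˡ {y = y} xy≉0 x≈0 = xy≉0 (trans (*-cong x≈0 refl) (zeroˡ y))

  *≉0⇒≉0ʳ : ∀ {x y} → ¬ x * y ≈ 0# → ¬ y ≈ 0#
  *≉0⇒≉0ʳ {x} xy≉0 y≈0 = xy≉0 (trans (*-cong refl y≈0) (zeroʳ x))

  ≉0⇒*≈0⇒≈0 : ∀ {x y} → ¬ x ≈ 0# → x * y ≈ 0# → y ≈ 0#
  ≉0⇒*≈0⇒≈0 {x} {y} x≉0 xy≈0 = begin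
    y             ≈⟨ sym (*-identityˡ y) ⟩
    1# * y        ≈⟨ *-cong (sym (trans (*-comm x⁻¹ x) (proj₂ (inverse x x≉0)))) refl ⟩
    (x⁻¹ * x) * y ≈⟨ *-assoc x⁻¹ x y ⟩
    x⁻¹ * (x * y) ≈⟨ *-cong refl xy≈0 ⟩
    x⁻¹ * 0#      ≈⟨ zeroʳ x⁻¹ ⟩
    0#            ∎
    where x⁻¹ = proj₁ (inverse x x≉0)

  pivot-eliminates : ∀ u p α → p * α ≈ 1# → (- (u * α)) * p + u ≈ 0#
  pivot-eliminates u p α pα≈1 = begin
    (- (u * α)) * p + u  ≈⟨ +-cong (sym (-‿distribˡ-* (u * α) p)) refl ⟩
    - ((u * α) * p) + u  ≈⟨ +-cong (-‿cong (trans (*-assoc u α p) (*-cong refl (trans (*-comm α p) pα≈1)))) refl ⟩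
    - (u * 1#) + u       ≈⟨ +-cong (-‿cong (*-identityʳ u)) refl ⟩
    - u + u              ≈⟨ -‿inverseˡ u ⟩
    0#                   ∎

  Σᶠ-cong : ∀ n {f g : Fin n → Carrier} → (∀ i → f i ≈ g i) → Σᶠ n f ≈ Σᶠ n g
  Σᶠ-cong zero    f≈g = refl
  Σᶠ-cong (suc n) f≈g = +-cong (f≈g Fin.zero) (Σᶠ-cong n (f≈g ∘ Fin.suc))

  Σᶠ-+ : ∀ n (f g : Fin n → Carrier) → Σᶠ n (λ i → f i + g i) ≈ Σᶠ n f + Σᶠ n g
  Σᶠ-+ zero    f g = sym (+-identityˡ 0#)
  Σᶠ-+ (suc n) f g = trans (+-cong refl (Σᶠ-+ n (f ∘ Fin.suc) (g ∘ Fin.suc))) (+-interchange _ _ _ _)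

  Σᶠ-*ˡ : ∀ n k (f : Fin n → Carrier) → Σᶠ n (λ i → k * f i) ≈ k * Σᶠ n f
  Σᶠ-*ˡ zero    k f = sym (zeroʳ k)
  Σᶠ-*ˡ (suc n) k f = trans (+-cong refl (Σᶠ-*ˡ n k (f ∘ Fin.suc))) (sym (distribˡ k _ _))

  Σᶠ≉0⇒∃≉0 : ∀ n (f : Fin n → Carrier) → ¬ Σᶠ n f ≈ 0# → ∃ λ i → ¬ f i ≈ 0#
  Σᶠ≉0⇒∃≉0 zero    f Σ≉0 = ⊥-elim (Σ≉0 refl)
  Σᶠ≉0⇒∃≉0 (suc n) f Σ≉0 with f Fin.zero ≟ 0#
  ... | no  f₀≉0 = Fin.zero , f₀≉0
  ... | yes f₀≈0 =
    let i , fᵢ≉0 = Σᶠ≉0⇒∃≉0 n (f ∘ Fin.suc) (λ Σ≈0 → Σ≉0 (trans (+-cong f₀≈0 Σ≈0) (+-identityˡ 0#)))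
    in Fin.suc i , fᵢ≉0

  ∗-linearˡ : ∀ {n} m (u z v : Vec n) → (((m ·v u) +v z) ∗ v) ≋ ((m ·v (u ∗ v)) +v (z ∗ v))
  ∗-linearˡ m u z v i = trans (distribʳ (v i) (m * u i) (z i)) (+-cong (*-assoc m (u i) (v i)) refl)

  ⟨⟩-congˡ : ∀ {n} {u u′ v : Vec n} → u ≋ u′ → ⟨ u , v ⟩ ≈ ⟨ u′ , v ⟩
  ⟨⟩-congˡ {n} u≋u′ = Σᶠ-cong n (λ i → *-cong (u≋u′ i) refl)

  ⟨⟩-congʳ : ∀ {n} {u v v′ : Vec n} → v ≋ v′ → ⟨ u , v ⟩ ≈ ⟨ u , v′ ⟩
  ⟨⟩-congʳ {n} v≋v′ = Σᶠ-cong n (λ i → *-cong refl (v≋v′ i))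

  ⟨⟩-comm : ∀ {n} (u v : Vec n) → ⟨ u , v ⟩ ≈ ⟨ v , u ⟩
  ⟨⟩-comm {n} u v = Σᶠ-cong n (λ i → *-comm (u i) (v i))

  ⟨⟩-linearˡ : ∀ {n} m (u z v : Vec n) → ⟨ (m ·v u) +v z , v ⟩ ≈ m * ⟨ u , v ⟩ + ⟨ z , v ⟩
  ⟨⟩-linearˡ {n} m u z v = begin
    ⟨ (m ·v u) +v z , v ⟩                      ≡⟨⟩
    Σᶠ n (λ i → (m * u i + z i) * v i)         ≈⟨ Σᶠ-cong n (∗-linearˡ m u z v) ⟩
    Σᶠ n (λ i → m * (u i * v i) + z i * v i)   ≈⟨ Σᶠ-+ n _ _ ⟩
    Σᶠ n (λ i → m * (u i * v i)) + ⟨ z , v ⟩   ≈⟨ +-cong (Σᶠ-*ˡ n m _) refl ⟩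
    m * ⟨ u , v ⟩ + ⟨ z , v ⟩                  ∎

  ⟨⟩-linearʳ : ∀ {n} m (v u z : Vec n) → ⟨ v , (m ·v u) +v z ⟩ ≈ m * ⟨ v , u ⟩ + ⟨ v , z ⟩
  ⟨⟩-linearʳ m v u z = begin
    ⟨ v , (m ·v u) +v z ⟩      ≈⟨ ⟨⟩-comm v _ ⟩
    ⟨ (m ·v u) +v z , v ⟩      ≈⟨ ⟨⟩-linearˡ m u z v ⟩
    m * ⟨ u , v ⟩ + ⟨ z , v ⟩  ≈⟨ +-cong (*-cong refl (⟨⟩-comm u v)) (⟨⟩-comm z v) ⟩
    m * ⟨ v , u ⟩ + ⟨ v , z ⟩  ∎

  ⟨⟩-updateAtʳ : ∀ {n} (u x : Vec n) k f → u k ≈ 0# → ⟨ u , updateAt x k f ⟩ ≈ ⟨ u , x ⟩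
  ⟨⟩-updateAtʳ {n} u x k f uₖ≈0 = Σᶠ-cong n term
    where
    term : ∀ i → u i * updateAt x k f i ≈ u i * x i
    term i with i ≟ᶠ k
    ... | yes ≡-refl = trans (trans (*-cong uₖ≈0 refl) (zeroˡ _)) (sym (trans (*-cong uₖ≈0 refl) (zeroˡ _)))
    ... | no  i≢k  = *-cong refl (reflexive (updateAt-minimal i k x i≢k))

  hamming-updateAt : ∀ {n} (x y : Vec n) k → ¬ x k ≈ y k →
    hamming x y ≡ suc (hamming (updateAt x k (λ _ → y k)) y)
  hamming-updateAt {suc n} x y Fin.zero xₖ≉yₖ with x Fin.zero ≟ y Fin.zero | y Fin.zero ≟ y Fin.zero
  ... | yes x₀≈y₀ | _     = ⊥-elim (xₖ≉yₖ x₀≈y₀)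
  ... | no  _     | yes _ = ≡-refl
  ... | no  _     | no y₀≉y₀ = ⊥-elim (y₀≉y₀ refl)
  hamming-updateAt {suc n} x y (Fin.suc k) xₖ≉yₖ with x Fin.zero ≟ y Fin.zero
  ... | yes _ = hamming-updateAt (x ∘ Fin.suc) (y ∘ Fin.suc) k xₖ≉yₖ
  ... | no  _ = cong suc (hamming-updateAt (x ∘ Fin.suc) (y ∘ Fin.suc) k xₖ≉yₖ)

  staircase⇒≤hamming : ∀ {n} w (a b : Fin w → Vec n) (x : Vec n) →
    (∀ i j → i ⊞ j ≤ w → ⟨ a i ∗ b j , x ⟩ ≈ 0#) →
    (∀ i j → i ⊞ j ≡ suc w → ¬ ⟨ a i ∗ b j , x ⟩ ≈ 0#) →
    w ≤ hamming x 0v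
  staircase⇒≤hamming zero a b x below anti = z≤n
  staircase⇒≤hamming {n} (suc w) a b x below anti =
    subst (suc w ≤_) (≡-sym (hamming-updateAt x 0v k xₖ≉0))
      (s≤s (staircase⇒≤hamming w a′ b′ x′ below′ anti′))
    where
    pivot : ∃ λ k → ¬ (a Fin.zero k * b (fromℕ w) k) * x k ≈ 0#
    pivot = Σᶠ≉0⇒∃≉0 n _ (anti Fin.zero (fromℕ w) (cong (suc ∘ suc) (toℕ-fromℕ w)))
    k = proj₁ pivot
    xₖ≉0 : ¬ x k ≈ 0#
    xₖ≉0 = *≉0⇒≉0ʳ (proj₂ pivot)
    a₀ₖ≉0 : ¬ a Fin.zero k ≈ 0#
    a₀ₖ≉0 = *≉0⇒≉0ˡ (*≉0⇒≉0ˡ (proj₂ pivot))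
    α = proj₁ (inverse _ a₀ₖ≉0)
    coeff : Fin w → Carrier
    coeff i = - (a (Fin.suc i) k * α)
    a′ b′ : Fin w → Vec n
    a′ i = (coeff i ·v a Fin.zero) +v a (Fin.suc i)
    b′ j = b (inject₁ j)
    x′ : Vec n
    x′ = updateAt x k (λ _ → 0#)

    reduce : ∀ i v → ⟨ a′ i ∗ v , x′ ⟩ ≈ coeff i * ⟨ a Fin.zero ∗ v , x ⟩ + ⟨ a (Fin.suc i) ∗ v , x ⟩
    reduce i v = begin
      ⟨ a′ i ∗ v , x′ ⟩  ≈⟨ ⟨⟩-updateAtʳ (a′ i ∗ v) x k _ a′ᵢvₖ≈0 ⟩
      ⟨ a′ i ∗ v , x ⟩   ≈⟨ ⟨⟩-congˡ (∗-linearˡ (coeff i) (a Fin.zero) (a (Fin.suc i)) v) ⟩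
      ⟨ (coeff i ·v (a Fin.zero ∗ v)) +v (a (Fin.suc i) ∗ v) , x ⟩  ≈⟨ ⟨⟩-linearˡ (coeff i) _ _ x ⟩
      coeff i * ⟨ a Fin.zero ∗ v , x ⟩ + ⟨ a (Fin.suc i) ∗ v , x ⟩  ∎
      where
      a′ᵢvₖ≈0 : a′ i k * v k ≈ 0#
      a′ᵢvₖ≈0 = trans (*-cong (pivot-eliminates _ _ α (proj₂ (inverse _ a₀ₖ≉0))) refl) (zeroˡ (v k))

    a₀-below : ∀ i j → i ⊞ j ≤ suc w → ⟨ a Fin.zero ∗ b′ j , x ⟩ ≈ 0#
    a₀-below i j le = below Fin.zero (inject₁ j) (≤-trans (zero⊞inject₁≤⊞ i j) le)

    below′ : ∀ i j → i ⊞ j ≤ w → ⟨ a′ i ∗ b′ j , x′ ⟩ ≈ 0#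
    below′ i j le = begin
      ⟨ a′ i ∗ b′ j , x′ ⟩  ≈⟨ reduce i (b′ j) ⟩
      coeff i * ⟨ a Fin.zero ∗ b′ j , x ⟩ + ⟨ a (Fin.suc i) ∗ b′ j , x ⟩
        ≈⟨ +-cong (*-cong refl (a₀-below i j (m≤n⇒m≤1+n le)))
                  (below (Fin.suc i) (inject₁ j) (subst (_≤ suc w) (≡-sym (⊞-suc-inject₁ i j)) (s≤s le))) ⟩
      coeff i * 0# + 0#     ≈⟨ trans (+-identityʳ _) (zeroʳ _) ⟩
      0#                    ∎

    anti′ : ∀ i j → i ⊞ j ≡ suc w → ¬ ⟨ a′ i ∗ b′ j , x′ ⟩ ≈ 0#
    anti′ i j eq ≈0 = anti (Fin.suc i) (inject₁ j) (≡-trans (⊞-suc-inject₁ i j) (cong suc eq)) (begin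
      ⟨ a (Fin.suc i) ∗ b′ j , x ⟩           ≈⟨ sym (+-identityˡ _) ⟩
      0# + ⟨ a (Fin.suc i) ∗ b′ j , x ⟩      ≈⟨ +-cong (sym (trans (*-cong refl (a₀-below i j (≤-reflexive eq))) (zeroʳ _))) refl ⟩
      coeff i * ⟨ a Fin.zero ∗ b′ j , x ⟩ + ⟨ a (Fin.suc i) ∗ b′ j , x ⟩  ≈⟨ sym (reduce i (b′ j)) ⟩
      ⟨ a′ i ∗ b′ j , x′ ⟩                  ≈⟨ ≈0 ⟩
      0#                                     ∎)

  ⊥-coset : ∀ {p n} {C₁ : Pred (Vec n) p} {v z : Vec n} → (C₁ ⊥) v → C₁ z →
    ∀ m u → ⟨ v , (m ·v u) +v z ⟩ ≈ m * ⟨ v , u ⟩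
  ⊥-coset {v = v} {z} v⊥C₁ z∈C₁ m u = begin
    ⟨ v , (m ·v u) +v z ⟩      ≈⟨ ⟨⟩-linearʳ m v u z ⟩
    m * ⟨ v , u ⟩ + ⟨ v , z ⟩  ≈⟨ +-cong refl (v⊥C₁ z z∈C₁) ⟩
    m * ⟨ v , u ⟩ + 0#         ≈⟨ +-identityʳ _ ⟩
    m * ⟨ v , u ⟩              ∎

  ⊥₁∩⊥x⊆⊥ : ∀ {p n} {C C₁ : Pred (Vec n) p} → IsLinearCode C₁ → QuotDimOne C C₁ →
    ∀ {x} → C x → ¬ C₁ x → ∀ {v} → (C₁ ⊥) v → ⟨ v , x ⟩ ≈ 0# → (C ⊥) v
  ⊥₁∩⊥x⊆⊥ L₁ (_ , c₀ , _ , _ , span) {x} x∈C x∉C₁ {v} v⊥C₁ v⊥x y y∈C =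
    let λ′ , z , z∈C₁ , y≋ = span y y∈C in begin
      ⟨ v , y ⟩                ≈⟨ ⟨⟩-congʳ y≋ ⟩
      ⟨ v , (λ′ ·v c₀) +v z ⟩  ≈⟨ ⊥-coset v⊥C₁ z∈C₁ λ′ c₀ ⟩
      λ′ * ⟨ v , c₀ ⟩          ≈⟨ *-cong refl v⊥c₀ ⟩
      λ′ * 0#                  ≈⟨ zeroʳ λ′ ⟩
      0#                       ∎
    where
    open IsLinearCode L₁ using (respects)
    μ = proj₁ (span x x∈C)
    z′ = proj₁ (proj₂ (span x x∈C))
    z′∈C₁ = proj₁ (proj₂ (proj₂ (span x x∈C)))
    x≋ = proj₂ (proj₂ (proj₂ (span x x∈C)))
    μ≉0 : ¬ μ ≈ 0#
    μ≉0 μ≈0 = x∉C₁ (respects (λ i → sym (trans (x≋ i)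
      (trans (+-cong (trans (*-cong μ≈0 refl) (zeroˡ _)) refl) (+-identityˡ _)))) z′∈C₁)
    v⊥c₀ : ⟨ v , c₀ ⟩ ≈ 0#
    v⊥c₀ = ≉0⇒*≈0⇒≈0 μ≉0 (trans (sym (⊥-coset v⊥C₁ z′∈C₁ μ c₀)) (trans (sym (⟨⟩-congʳ x≋)) v⊥x))

open import Data.Nat using (_+_)

theorem1p2 : ∀ {c ℓ p : Level} (F : FiniteField c ℓ) → let open Code F in
    ∀ (n : ℕ) (C C₁ : Pred (Vec n) p) →
    IsLinearCode C → IsLinearCode C₁ → QuotDimOne C C₁ →
    ∀ (w : ℕ) (a b : Fin w → Vec n) →
    (∀ i j → suc (toℕ i) + suc (toℕ j) ≤ w → (C ⊥) (a i ∗ b j)) →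
    (∀ i j → suc (toℕ i) + suc (toℕ j) ≡ suc w →
      (C₁ ⊥) (a i ∗ b j) × ¬ (C ⊥) (a i ∗ b j)) →
    QuotDist≥ C C₁ w
theorem1p2 F n C C₁ _ L₁ Q w a b below anti x x∈C x∉C₁ =
  staircase⇒≤hamming F w a b x
    (λ i j le → below i j le x x∈C)
    (λ i j eq ⊥x → proj₂ (anti i j eq) (⊥₁∩⊥x⊆⊥ F L₁ Q x∈C x∉C₁ (proj₁ (anti i j eq)) ⊥x))
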